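{- Let $n\ge0$. The active sites of $e\in\mathbf{I}_n(\underline{10}0)$ are exactly $\{0,1,\dots,n\}\setminus\{e_{i+1}:i\in\mathrm{Des}(e)\}$. The active sites of $e\in\mathbf{I}_n(\underline{10}1)$ are exactly $\{0,1,\dots,n\}\setminus\{e_i:i\in\mathrm{Des}(e)\}$. In particular, for $n\ge1$, $e_n$ is an active site of every $e\in\mathbf{I}_n(\underline{10}1)$.
   Context: $\mathbf{I}_n$ is the set of integer sequences $e_1\dots e_n$ with $0\le e_i<i$. $\mathbf{I}_n(\underline{10}0)$ is the set of $e\in\mathbf{I}_n$ with no positions $i<k$, $i+1<k$, such that $e_i>e_{i+1}=e_k$; $\mathbf{I}_n(\underline{10}1)$ is the set of $e\in\mathbf{I}_n$ with no positions $i+1<k$ such that $e_i=e_k>e_{i+1}$. For $p\in\{\underline{10}0,\underline{10}1\}$ and $e\in\mathbf{I}_n(p)$, a value $h\in\{0,1,\dots,n\}$ is an active site of $e$ if $e_1\dots e_nh\in\mathbf{I}_{n+1}(p)$. $\mathrm{Des}(e)=\{i\in[n-1]:e_i>e_{i+1}\}$. -}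

module Defs where

open import Data.Nat using (ℕ; zero; suc; _<_; _≤_)
open import Data.Fin using (Fin; zero; suc; toℕ)
open import Data.Product using (_×_; Σ; ∃-syntax)
open import Data.Empty using (⊥)
open import Relation.Binary.PropositionalEquality using (_≡_)

-- A finite sequence e₁…eₙ is represented as a function Fin n → ℕ.
-- Position i : Fin n (0-based) corresponds to the paper's position toℕ i + 1.
Seq : ℕ → Set
Seq n = Fin n → ℕ

-- e ∈ Iₙ : 0 ≤ e_i < i (1-based), i.e. e i < suc (toℕ i) (0-based).
IsInv : (n : ℕ) → Seq n → Set
IsInv n e = (i : Fin n) → e i < suc (toℕ i)

Avoids100 : (n : ℕ) → Seq n → Set
Avoids100 n e = (i j k : Fin n) → toℕ j ≡ suc (toℕ i) → toℕ j < toℕ k →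
                e j < e i → e j ≡ e k → ⊥

Avoids101 : (n : ℕ) → Seq n → Set
Avoids101 n e = (i j k : Fin n) → toℕ j ≡ suc (toℕ i) → toℕ j < toℕ k →
                e i ≡ e k → e j < e i → ⊥

I100 : (n : ℕ) → Seq n → Set
I100 n e = IsInv n e × Avoids100 n e

I101 : (n : ℕ) → Seq n → Set
I101 n e = IsInv n e × Avoids101 n e

snoc : {n : ℕ} → Seq n → ℕ → Seq (suc n)
snoc {zero}  e h zero    = h
snoc {suc n} e h zero    = e zero
snoc {suc n} e h (suc i) = snoc (λ x → e (suc x)) h i

ActiveSite100 : (n : ℕ) → Seq n → ℕ → Set
ActiveSite100 n e h = h ≤ n × I100 (suc n) (snoc e h)

ActiveSite101 : (n : ℕ) → Seq n → ℕ → Set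
ActiveSite101 n e h = h ≤ n × I101 (suc n) (snoc e h)

InDesNext : (n : ℕ) → Seq n → ℕ → Set
InDesNext n e h = ∃[ i ] ∃[ j ] (toℕ {n} j ≡ suc (toℕ {n} i) × e j < e i × e j ≡ h)

InDesTop : (n : ℕ) → Seq n → ℕ → Set
InDesTop n e h = ∃[ i ] ∃[ j ] (toℕ {n} j ≡ suc (toℕ {n} i) × e j < e i × e i ≡ h)

module Submission where

-- Both patterns 1̲0̲0 and 1̲0̲1 have the same shape: an occurrence is a pair of
-- adjacent positions i, i+1 and a later position k whose values satisfy a
-- fixed relation  Occ eᵢ eᵢ₊₁ eₖ.  We therefore work with an arbitrary such
-- relation.  Appending h to e ∈ Iₙ can only create new occurrences whose last
-- position k is the new one, because the adjacent pair must lie strictly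
-- before k.  Hence, when e avoids the pattern, e·h avoids it exactly when no
-- adjacent pair of e "completes" to an occurrence with value h; together with
-- the bound h ≤ n (which keeps e·h an inversion sequence) this is the general
-- description of active sites.  For 1̲0̲0 resp. 1̲0̲1 the completing pairs are
-- the descents with eᵢ₊₁ = h resp. eᵢ = h, giving the first two claims.  The
-- third follows from the second: a descent (i, i+1) with eᵢ = eₙ would be an
-- occurrence of 1̲0̲1 ending at n, or (if i+1 = n) satisfy eₙ < eᵢ = eₙ.

open import Defs
open import Data.Nat using (ℕ; suc; _≤_; _<_; s≤s)
open import Data.Nat.Properties using (≤-trans; ≤-pred; n≤1+n; <⇒≱; 1+n≰n; <-irrefl)
open import Data.Fin using (Fin; toℕ; fromℕ; inject₁)
open import Data.Fin.Properties using (toℕ-fromℕ; toℕ-inject₁; inject₁ℕ<; ≤fromℕ)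
open import Data.Fin.Relation.Unary.Top using (view; ‵fromℕ; ‵inject₁)
open import Data.Product using (_×_; _,_; ∃-syntax)
open import Data.Empty using (⊥)
open import Relation.Nullary using (¬_)
open import Relation.Binary.PropositionalEquality using (_≡_; refl; sym; trans; cong; subst; subst₂)
open import Function.Bundles using (_⇔_; mk⇔; Equivalence)

snoc-inject₁ : {n : ℕ} (e : Seq n) (h : ℕ) (i : Fin n) → snoc e h (inject₁ i) ≡ e i
snoc-inject₁ {suc n} e h Fin.zero    = refl
snoc-inject₁ {suc n} e h (Fin.suc i) = snoc-inject₁ (λ x → e (Fin.suc x)) h i

snoc-fromℕ : {n : ℕ} (e : Seq n) (h : ℕ) → snoc e h (fromℕ n) ≡ h
snoc-fromℕ {ℕ.zero} e h = refl
snoc-fromℕ {suc n}  e h = snoc-fromℕ (λ x → e (Fin.suc x)) h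

snoc-isInv : {n : ℕ} (e : Seq n) (h : ℕ) → h ≤ n → IsInv n e → IsInv (suc n) (snoc e h)
snoc-isInv {n} e h h≤n inv x with view x
... | ‵fromℕ =
  subst₂ (λ a b → a < suc b) (sym (snoc-fromℕ e h)) (sym (toℕ-fromℕ n)) (s≤s h≤n)
... | ‵inject₁ i =
  subst₂ (λ a b → a < suc b) (sym (snoc-inject₁ e h i)) (sym (toℕ-inject₁ i)) (inv i)

inject₁<fromℕ : {n : ℕ} (i : Fin n) → toℕ (inject₁ i) < toℕ (fromℕ n)
inject₁<fromℕ {n} i = subst (toℕ (inject₁ i) <_) (sym (toℕ-fromℕ n)) (inject₁ℕ< i)

nothing-after-fromℕ : {n : ℕ} (k : Fin (suc n)) → ¬ (toℕ (fromℕ n) < toℕ k)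
nothing-after-fromℕ {n} k last<k = <⇒≱ last<k (≤fromℕ k)

Adjacent : {n : ℕ} → Fin n → Fin n → Set
Adjacent i j = toℕ j ≡ suc (toℕ i)

nothing-adjacent-fromℕ : {n : ℕ} (j : Fin (suc n)) → ¬ Adjacent (fromℕ n) j
nothing-adjacent-fromℕ {n} j adj = 1+n≰n (subst (_≤ toℕ (fromℕ n)) adj (≤fromℕ j))

adjacent-inject₁ : {n : ℕ} {i j : Fin n} → Adjacent i j → Adjacent (inject₁ i) (inject₁ j)
adjacent-inject₁ {i = i} {j} adj = trans (toℕ-inject₁ j) (trans adj (cong suc (sym (toℕ-inject₁ i))))

adjacent-inject₁⁻¹ : {n : ℕ} {i j : Fin n} → Adjacent (inject₁ i) (inject₁ j) → Adjacent i j
adjacent-inject₁⁻¹ {i = i} {j} adj = trans (sym (toℕ-inject₁ j)) (trans adj (cong suc (toℕ-inject₁ i)))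

Pattern : Set₁
Pattern = ℕ → ℕ → ℕ → Set

AvoidsPair : Pattern → {n : ℕ} → Seq n → Set
AvoidsPair Occ {n} e =
  (i j k : Fin n) → Adjacent i j → toℕ j < toℕ k → Occ (e i) (e j) (e k) → ⊥

Completes : Pattern → {n : ℕ} → Seq n → ℕ → Set
Completes Occ {n} e h = ∃[ i ] ∃[ j ] (Adjacent {n} i j × Occ (e i) (e j) h)

transport : (Occ : Pattern) {a a′ b b′ c c′ : ℕ} →
            a ≡ a′ → b ≡ b′ → c ≡ c′ → Occ a b c → Occ a′ b′ c′
transport Occ refl refl refl o = o

avoids-snoc⇒¬completes : (Occ : Pattern) {n : ℕ} (e : Seq n) (h : ℕ) →
                         AvoidsPair Occ (snoc e h) → ¬ Completes Occ e h
avoids-snoc⇒¬completes Occ e h av (i , j , adj , o) =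
  av (inject₁ i) (inject₁ j) (fromℕ _) (adjacent-inject₁ adj) (inject₁<fromℕ j)
     (transport Occ (sym (snoc-inject₁ e h i)) (sym (snoc-inject₁ e h j)) (sym (snoc-fromℕ e h)) o)

¬completes⇒avoids-snoc : (Occ : Pattern) {n : ℕ} (e : Seq n) (h : ℕ) →
                         AvoidsPair Occ e → ¬ Completes Occ e h → AvoidsPair Occ (snoc e h)
¬completes⇒avoids-snoc Occ e h av nc i j k adj j<k o with view j | view i | view k
... | ‵fromℕ      | _           | _  = nothing-after-fromℕ k j<k
... | ‵inject₁ j′ | ‵fromℕ      | _  = nothing-adjacent-fromℕ _ adj
... | ‵inject₁ j′ | ‵inject₁ i′ | ‵fromℕ =
  nc (i′ , j′ , adjacent-inject₁⁻¹ adj ,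
      transport Occ (snoc-inject₁ e h i′) (snoc-inject₁ e h j′) (snoc-fromℕ e h) o)
... | ‵inject₁ j′ | ‵inject₁ i′ | ‵inject₁ k′ =
  av i′ j′ k′ (adjacent-inject₁⁻¹ adj)
     (subst₂ _<_ (toℕ-inject₁ j′) (toℕ-inject₁ k′) j<k)
     (transport Occ (snoc-inject₁ e h i′) (snoc-inject₁ e h j′) (snoc-inject₁ e h k′) o)

active-sites : (Occ : Pattern) (A : (m : ℕ) → Seq m → Set) →
               (∀ {m} {e : Seq m} → A m e ⇔ AvoidsPair Occ e) →
               (n : ℕ) (e : Seq n) → IsInv n e × A n e → (h : ℕ) →
               (h ≤ n × IsInv (suc n) (snoc e h) × A (suc n) (snoc e h))
                 ⇔ (h ≤ n × ¬ Completes Occ e h)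
active-sites Occ A A⇔avoids n e (inv , a) h = mk⇔ active⇒ ⇒active
  where
  active⇒ : h ≤ n × IsInv (suc n) (snoc e h) × A (suc n) (snoc e h) → h ≤ n × ¬ Completes Occ e h
  active⇒ (h≤n , _ , a′) = h≤n , avoids-snoc⇒¬completes Occ e h (Equivalence.to A⇔avoids a′)

  ⇒active : h ≤ n × ¬ Completes Occ e h → h ≤ n × IsInv (suc n) (snoc e h) × A (suc n) (snoc e h)
  ⇒active (h≤n , nc) =
    h≤n , snoc-isInv e h h≤n inv ,
    Equivalence.from A⇔avoids (¬completes⇒avoids-snoc Occ e h (Equivalence.to A⇔avoids a) nc)

-- The two patterns.  With these choices Completes is literally the set of
-- values eᵢ₊₁ resp. eᵢ over descents i.

Occ100 : Pattern
Occ100 a b c = b < a × b ≡ c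

Occ101 : Pattern
Occ101 a b c = b < a × a ≡ c

avoids100⇔ : {n : ℕ} {e : Seq n} → Avoids100 n e ⇔ AvoidsPair Occ100 e
avoids100⇔ = mk⇔ (λ av i j k adj j<k (b<a , b≡c) → av i j k adj j<k b<a b≡c)
                 (λ av i j k adj j<k b<a b≡c → av i j k adj j<k (b<a , b≡c))

avoids101⇔ : {n : ℕ} {e : Seq n} → Avoids101 n e ⇔ AvoidsPair Occ101 e
avoids101⇔ = mk⇔ (λ av i j k adj j<k (b<a , a≡c) → av i j k adj j<k a≡c b<a)
                 (λ av i j k adj j<k a≡c b<a → av i j k adj j<k (b<a , a≡c))

last-bounded : (m : ℕ) (e : Seq (suc m)) → IsInv (suc m) e → e (fromℕ m) ≤ m
last-bounded m e inv = ≤-pred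
  (subst (λ b → e (fromℕ m) < suc b) (toℕ-fromℕ m) (inv (fromℕ m)))

last-not-descent-top : (m : ℕ) (e : Seq (suc m)) → Avoids101 (suc m) e →
                       ¬ InDesTop (suc m) e (e (fromℕ m))
last-not-descent-top m e av (i , j , adj , b<a , a≡last) with view j
... | ‵fromℕ      = <-irrefl (sym a≡last) b<a
... | ‵inject₁ j′ = av i (inject₁ j′) (fromℕ m) adj (inject₁<fromℕ j′) a≡last b<a

lemma3p8 :
    ((n : ℕ) (e : Seq n) → I100 n e → (h : ℕ) →
       ActiveSite100 n e h ⇔ (h ≤ n × ¬ InDesNext n e h))
    × ((n : ℕ) (e : Seq n) → I101 n e → (h : ℕ) →
       ActiveSite101 n e h ⇔ (h ≤ n × ¬ InDesTop n e h))
    × ((m : ℕ) (e : Seq (suc m)) → I101 (suc m) e →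
       ActiveSite101 (suc m) e (e (fromℕ m)))
lemma3p8 = active-sites Occ100 Avoids100 avoids100⇔
         , sites101
         , λ m e (inv , av) → Equivalence.from (sites101 (suc m) e (inv , av) (e (fromℕ m)))
             (≤-trans (last-bounded m e inv) (n≤1+n m) , last-not-descent-top m e av)
  where
  sites101 : (n : ℕ) (e : Seq n) → I101 n e → (h : ℕ) →
             ActiveSite101 n e h ⇔ (h ≤ n × ¬ InDesTop n e h)
  sites101 = active-sites Occ101 Avoids101 avoids101⇔
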